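{- Let $q=[a,b,c]$ be an integral form of discriminant $D=b^2-4ac>0$. If $q$ is Z-reduced then $\sqrt{D+4}\le b\le (D+1)/2$, and if $q$ is Z*-reduced then $-(D+1)/2\le b\le-\sqrt{D+4}$.
   Context: A form $[a,b,c]=ax^2+bxy+cy^2$ (integer coefficients) is Z-reduced if $a,c>0$ and $b>a+c$; it is Z*-reduced if $a,c>0$ and $a+b+c<0$. -}

module Defs where

open import Data.Integer using (ℤ; +_; _+_; _-_; _*_; -_; _≤_; _<_; 0ℤ)
open import Data.Product using (_×_)

-- A binary quadratic form [a,b,c] = a x^2 + b x y + c y^2 with integer coefficients.
record Form : Set where
  constructor [_,_,_]
  field
    a : ℤ
    b : ℤ
    c : ℤ
open Form public

disc : Form → ℤ
disc q = b q * b q - + 4 * a q * c q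

ZReduced : Form → Set
ZReduced q = (0ℤ < a q) × (0ℤ < c q) × (a q + c q < b q)

ZStarReduced : Form → Set
ZStarReduced q = (0ℤ < a q) × (0ℤ < c q) × (a q + b q + c q < 0ℤ)

-- Real inequality  √N ≤ x  for integers N ≥ 0, x, written out over ℤ:
-- it holds iff x ≥ 0 and N ≤ x².
SqrtLe : ℤ → ℤ → Set
SqrtLe N x = (0ℤ ≤ x) × (N ≤ x * x)

-- Real inequality  x ≤ (N)/2  (rational division), written out over ℤ: 2x ≤ N.
LeHalf : ℤ → ℤ → Set
LeHalf x N = + 2 * x ≤ N

-- For a Z-reduced form, a + c ≤ b - 1 together with a, c ≥ 1 gives
-- 4 ≤ 4ac ≤ (a + c)² ≤ (b - 1)²: the left inequality is b² - D ≥ 4, and the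
-- right one rearranges to 2b ≤ D + 1. A form [a,b,c] is Z*-reduced exactly
-- when [a,-b,c] is Z-reduced, and negating b does not change D.
module Submission where

open import Defs
open import Data.Integer
  using (+_; _+_; _-_; -_; _*_; _≤_; _<_; 0ℤ; +0; 1ℤ; -1ℤ; +[1+_]; -[1+_]; +≤+; +<+; nonNegative)
open import Data.Integer.Properties
  using (≤-trans; ≤-reflexive; <⇒≤; +-comm; +-mono-≤; +-monoʳ-≤; +-monoˡ-<; neg-mono-≤;
         *-monoˡ-≤-nonNeg; *-monoʳ-≤-nonNeg; 0≤i-j⇒j≤i; i<j⇒i≤pred[j]; module ≤-Reasoning)
open import Data.Integer.Tactic.RingSolver using (solve)
open import Data.List using (_∷_; [])
open import Data.Nat using (z≤n; s≤s)
open import Data.Product using (_×_; _,_)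
open import Relation.Binary.PropositionalEquality using (_≡_; subst)

0≤i*i : ∀ i → 0ℤ ≤ i * i
0≤i*i (+ n)     = *-monoʳ-≤-nonNeg (+ n) {0ℤ} {+ n} (+≤+ z≤n)
0≤i*i -[1+ n ] = +≤+ z≤n

*-mono-≤-square : ∀ {i j} → 0ℤ ≤ i → i ≤ j → i * i ≤ j * j
*-mono-≤-square {i} {j} 0≤i i≤j = begin
  i * i  ≤⟨ *-monoˡ-≤-nonNeg i {{nonNegative 0≤i}} i≤j ⟩
  i * j  ≤⟨ *-monoʳ-≤-nonNeg j {{nonNegative (≤-trans 0≤i i≤j)}} i≤j ⟩
  j * j  ∎
  where open ≤-Reasoning

4*i*j≤[i+j]² : ∀ i j → + 4 * i * j ≤ (i + j) * (i + j)
4*i*j≤[i+j]² i j = 0≤i-j⇒j≤i (subst (0ℤ ≤_) square-difference (0≤i*i (i - j)))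
  where
  square-difference : (i - j) * (i - j) ≡ (i + j) * (i + j) - + 4 * i * j
  square-difference = solve (i ∷ j ∷ [])

1≤i*j : ∀ {i j} → 0ℤ < i → 0ℤ < j → 1ℤ ≤ i * j
1≤i*j {+[1+ m ]} {+[1+ n ]} _        _        = +≤+ (s≤s z≤n)
1≤i*j {+0}       {_}        (+<+ ()) _
1≤i*j {+[1+ m ]} {+0}       _        (+<+ ())

ZReduced⇒bounds : ∀ q → ZReduced q →
                  SqrtLe (disc q + + 4) (b q) × LeHalf (b q) (disc q + + 1)
ZReduced⇒bounds [ a , b , c ] (0<a , 0<c , a+c<b) = (0≤b , disc+4≤b²) , 2b≤disc+1
  where
  open ≤-Reasoning

  0≤a+c : 0ℤ ≤ a + c
  0≤a+c = +-mono-≤ (<⇒≤ 0<a) (<⇒≤ 0<c)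

  0≤b : 0ℤ ≤ b
  0≤b = ≤-trans 0≤a+c (<⇒≤ a+c<b)

  a+c≤b-1 : a + c ≤ b - 1ℤ
  a+c≤b-1 = ≤-trans (i<j⇒i≤pred[j] a+c<b) (≤-reflexive (+-comm -1ℤ b))

  4≤4ac : + 4 ≤ + 4 * a * c
  4≤4ac = begin
    + 4 * 1ℤ       ≤⟨ *-monoˡ-≤-nonNeg (+ 4) (1≤i*j 0<a 0<c) ⟩
    + 4 * (a * c)  ≡⟨ solve (a ∷ c ∷ []) ⟩
    + 4 * a * c    ∎

  4ac≤[b-1]² : + 4 * a * c ≤ (b - 1ℤ) * (b - 1ℤ)
  4ac≤[b-1]² = ≤-trans (4*i*j≤[i+j]² a c) (*-mono-≤-square 0≤a+c a+c≤b-1)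

  disc+4≤b² : b * b - + 4 * a * c + + 4 ≤ b * b
  disc+4≤b² = begin
    b * b - + 4 * a * c + + 4  ≡⟨ solve (a ∷ b ∷ c ∷ []) ⟩
    (b * b + + 4) - + 4 * a * c ≤⟨ +-monoʳ-≤ (b * b + + 4) (neg-mono-≤ 4≤4ac) ⟩
    (b * b + + 4) - + 4         ≡⟨ solve (b ∷ []) ⟩
    b * b                       ∎

  2b≤disc+1 : + 2 * b ≤ b * b - + 4 * a * c + + 1
  2b≤disc+1 = begin
    + 2 * b                             ≡⟨ solve (b ∷ []) ⟩
    (b * b + 1ℤ) - (b - 1ℤ) * (b - 1ℤ)  ≤⟨ +-monoʳ-≤ (b * b + 1ℤ) (neg-mono-≤ 4ac≤[b-1]²) ⟩
    (b * b + 1ℤ) - + 4 * a * c          ≡⟨ solve (a ∷ b ∷ c ∷ []) ⟩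
    b * b - + 4 * a * c + + 1           ∎

negate-b : Form → Form
negate-b [ a , b , c ] = [ a , - b , c ]

ZStarReduced⇒ZReduced-negate-b : ∀ q → ZStarReduced q → ZReduced (negate-b q)
ZStarReduced⇒ZReduced-negate-b [ a , b , c ] (0<a , 0<c , a+b+c<0) = 0<a , 0<c , a+c<-b
  where
  open ≤-Reasoning
  a+c<-b : a + c < - b
  a+c<-b = begin-strict
    a + c            ≡⟨ solve (a ∷ b ∷ c ∷ []) ⟩
    a + b + c + - b  <⟨ +-monoˡ-< (- b) a+b+c<0 ⟩
    0ℤ + - b         ≡⟨ solve (b ∷ []) ⟩
    - b              ∎

disc-negate-b : ∀ q → disc (negate-b q) ≡ disc q
disc-negate-b [ a , b , c ] = neg-square
  where
  neg-square : - b * - b - + 4 * a * c ≡ b * b - + 4 * a * c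
  neg-square = solve (a ∷ b ∷ c ∷ [])

ZStarReduced⇒bounds : ∀ q → ZStarReduced q →
                      SqrtLe (disc q + + 4) (- b q) × LeHalf (- b q) (disc q + + 1)
ZStarReduced⇒bounds q r =
  subst (λ D → SqrtLe (D + + 4) (- b q) × LeHalf (- b q) (D + + 1))
        (disc-negate-b q)
        (ZReduced⇒bounds (negate-b q) (ZStarReduced⇒ZReduced-negate-b q r))

corollary7p7 : (q : Form) → 0ℤ < disc q →
               (ZReduced q → SqrtLe (disc q + + 4) (b q) × LeHalf (b q) (disc q + + 1))
               × (ZStarReduced q → SqrtLe (disc q + + 4) (- b q) × LeHalf (- b q) (disc q + + 1))
corollary7p7 q _ = ZReduced⇒bounds q , ZStarReduced⇒bounds q
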